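{- Let $G_1$ and $G_2$ be graphs with disjoint vertex sets. Then $\mathrm{indthin}(G_1\cup G_2)=\max\{\mathrm{indthin}(G_1),\mathrm{indthin}(G_2)\}$ and $\mathrm{indpthin}(G_1\cup G_2)=\max\{\mathrm{indpthin}(G_1),\mathrm{indpthin}(G_2)\}$.
   Context: Graphs are finite, simple, undirected. The union $G_1\cup G_2$ is $(V_1\cup V_2, E_1\cup E_2)$. For a graph $G=(V,E)$, an ordering $v_1,\dots,v_n$ of $V$ and a partition of $V$ are consistent if for every $r<s<t$, whenever $v_r,v_s$ are in the same class and $v_tv_r\in E$, then $v_tv_s\in E$; they are strongly consistent if moreover for every $r<s<t$, whenever $v_s,v_t$ are in the same class and $v_tv_r\in E$, then $v_sv_r\in E$. $\mathrm{indthin}(G)$ (independent thinness) is the minimum $k$ such that some ordering of $V$ and some partition of $V$ into $k$ independent sets are consistent; $\mathrm{indpthin}(G)$ (independent proper thinness) is defined likewise with strongly consistent. -}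

module Defs where

open import Data.Nat using (ℕ; _+_; _≤_)
open import Data.Fin using (Fin; _<_; splitAt)
open import Data.Fin.Permutation using (Permutation′; _⟨$⟩ʳ_)
open import Data.Sum using (_⊎_; inj₁; inj₂)
open import Data.Product using (Σ; _×_; ∃)
open import Data.Empty using (⊥)
open import Relation.Nullary using (¬_)
open import Relation.Binary.PropositionalEquality using (_≡_)

record Graph (n : ℕ) : Set₁ where
  field
    E       : Fin n → Fin n → Set
    E-sym   : ∀ {u v} → E u v → E v u
    E-irrefl : ∀ {u} → ¬ E u u
open Graph public

-- Union of two graphs with disjoint vertex sets: the vertex set of G₁ ∪ G₂ is
-- Fin (n + m), the first n vertices being those of G₁, the last m those of G₂.
unionE : ∀ {n m} → Graph n → Graph m → Fin (n + m) → Fin (n + m) → Set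
unionE {n} G₁ G₂ u v with splitAt n u | splitAt n v
... | inj₁ a | inj₁ b = E G₁ a b
... | inj₂ a | inj₂ b = E G₂ a b
... | inj₁ _ | inj₂ _ = ⊥
... | inj₂ _ | inj₁ _ = ⊥

unionE-sym : ∀ {n m} (G₁ : Graph n) (G₂ : Graph m) {u v} → unionE G₁ G₂ u v → unionE G₁ G₂ v u
unionE-sym {n} G₁ G₂ {u} {v} e with splitAt n u | splitAt n v
... | inj₁ a | inj₁ b = E-sym G₁ e
... | inj₂ a | inj₂ b = E-sym G₂ e

unionE-irrefl : ∀ {n m} (G₁ : Graph n) (G₂ : Graph m) {u} → ¬ unionE G₁ G₂ u u
unionE-irrefl {n} G₁ G₂ {u} e with splitAt n u
... | inj₁ a = E-irrefl G₁ e
... | inj₂ a = E-irrefl G₂ e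

_∪_ : ∀ {n m} → Graph n → Graph m → Graph (n + m)
G₁ ∪ G₂ = record { E = unionE G₁ G₂ ; E-sym = unionE-sym G₁ G₂ ; E-irrefl = unionE-irrefl G₁ G₂ }

-- An ordering v₁,…,vₙ of the vertices: position i ↦ vertex σ i.
-- A partition into k classes: a class-assignment c : Fin n → Fin k.

Consistent : ∀ {n k} → Graph n → Permutation′ n → (Fin n → Fin k) → Set
Consistent G σ c = ∀ r s t → r < s → s < t →
  c (σ ⟨$⟩ʳ r) ≡ c (σ ⟨$⟩ʳ s) → E G (σ ⟨$⟩ʳ t) (σ ⟨$⟩ʳ r) → E G (σ ⟨$⟩ʳ t) (σ ⟨$⟩ʳ s)

StronglyConsistent : ∀ {n k} → Graph n → Permutation′ n → (Fin n → Fin k) → Set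
StronglyConsistent G σ c = Consistent G σ c ×
  (∀ r s t → r < s → s < t →
    c (σ ⟨$⟩ʳ s) ≡ c (σ ⟨$⟩ʳ t) → E G (σ ⟨$⟩ʳ t) (σ ⟨$⟩ʳ r) → E G (σ ⟨$⟩ʳ s) (σ ⟨$⟩ʳ r))

Independent : ∀ {n k} → Graph n → (Fin n → Fin k) → Set
Independent G c = ∀ u v → c u ≡ c v → ¬ E G u v

HasIndThin : ∀ {n} → Graph n → ℕ → Set
HasIndThin {n} G k = Σ (Permutation′ n) λ σ → Σ (Fin n → Fin k) λ c → Independent G c × Consistent G σ c

HasIndPThin : ∀ {n} → Graph n → ℕ → Set
HasIndPThin {n} G k = Σ (Permutation′ n) λ σ → Σ (Fin n → Fin k) λ c → Independent G c × StronglyConsistent G σ c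

IndThin : ∀ {n} → Graph n → ℕ → Set
IndThin G k = HasIndThin G k × (∀ j → HasIndThin G j → k ≤ j)

IndPThin : ∀ {n} → Graph n → ℕ → Set
IndPThin G k = HasIndPThin G k × (∀ j → HasIndPThin G j → k ≤ j)

module Submission where

-- Both consistency conditions are of the form "for all positions r < s < t,
-- a rule R holds at the vertices (σ r, σ s, σ t)", where R only mentions the
-- classes of these three vertices and edges between them, and is vacuous
-- unless the vertex at t is adjacent to the vertex at r.  Two facts follow.
--
--   * Induced subgraphs inherit: restricting an ordering of H to an induced
--     copy of G (i.e. sorting the vertices of G by their position in H)
--     preserves increasing triples, and both rules transfer along an induced
--     embedding.  Hence indthin(G₁ ∪ G₂) ≥ indthin(Gᵢ), and likewise for
--     indpthin.
--   * Concatenation: placing an ordering of G₁ before one of G₂ and merging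
--     the two families of classes (classes of G₁ and G₂ may be shared, as no
--     edge crosses) gives a consistent ordering of G₁ ∪ G₂ with max(k₁, k₂)
--     classes: in an ordered triple r < s < t with t adjacent to r, all three
--     positions lie in the same part.

open import Defs
open import Data.Nat using (ℕ; suc; _+_; _⊔_)
import Data.Nat as ℕ
import Data.Nat.Properties as ℕₚ
open import Data.Fin using (Fin; _<_; _↑ˡ_; _↑ʳ_; splitAt; toℕ; fromℕ<; inject≤; punchOut)
open import Data.Fin.Properties
  using (any?; _≟_; punchOut-injective; injective⇒≤; toℕ-injective; toℕ-fromℕ<; toℕ<n;
         toℕ-↑ˡ; toℕ-↑ʳ; ↑ˡ-injective; ↑ʳ-injective; splitAt-↑ˡ; splitAt-↑ʳ;
         splitAt⁻¹-↑ˡ; splitAt⁻¹-↑ʳ; +↔⊎; inject≤-injective)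
open import Data.Fin.Subset using (Subset; _∈_; _∉_; _⊂_; ∣_∣; ⊤)
open import Data.Fin.Subset.Properties using (p⊂q⇒∣p∣<∣q∣; ∈⊤; ∣⊤∣≡n)
open import Data.Fin.Permutation using (Permutation′; _⟨$⟩ʳ_; _⟨$⟩ˡ_; permutation; inverseʳ; flip)
open import Data.Vec using (tabulate)
open import Data.Vec.Properties using (lookup∘tabulate; lookup⇒[]=; []=⇒lookup)
open import Data.Bool.Properties using (T-≡)
open import Data.Product using (∃; _×_; _,_; proj₁; proj₂)
open import Data.Sum using (inj₁; inj₂; [_,_]′)
open import Data.Sum.Function.Propositional using (_⊎-↔_)
open import Data.Empty using (⊥-elim)
open import Function using (_∘_; id)
open import Function.Bundles using (_⇔_; mk⇔; Equivalence)
open import Function.Definitions using (Injective)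
open import Function.Properties.Inverse using (↔-trans; ↔-sym)
open import Relation.Nullary using (¬_; yes; no; contradiction)
open import Relation.Binary using (tri<; tri≈; tri>)
open import Relation.Binary.PropositionalEquality using (_≡_; _≢_; refl; sym; trans; cong; subst; subst₂)

open Equivalence using (to; from)

-- An injective map from a finite set to itself is onto (a pigeonhole argument:
-- a missed value would give an injection Fin (suc n) → Fin n).
injective⇒surjective : ∀ {n} (f : Fin n → Fin n) → Injective _≡_ _≡_ f → ∀ y → ∃ λ x → f x ≡ y
injective⇒surjective {suc n} f f-injective y with any? (λ x → f x ≟ y)
... | yes hit = hit
... | no miss = contradiction (injective⇒≤ punched-injective) ℕₚ.1+n≰n
  where
  misses : ∀ x → y ≢ f x
  misses x y≡fx = miss (x , sym y≡fx)

  punched : Fin (suc n) → Fin n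
  punched x = punchOut (misses x)

  punched-injective : Injective _≡_ _≡_ punched
  punched-injective {x} {x′} = f-injective ∘ punchOut-injective (misses x) (misses x′)

injective⇒permutation : ∀ {n} (f : Fin n → Fin n) → Injective _≡_ _≡_ f → Permutation′ n
injective⇒permutation f f-injective =
  permutation f (proj₁ ∘ onto) (proj₂ ∘ onto) (λ x → f-injective (proj₂ (onto (f x))))
  where
  onto : ∀ y → ∃ λ x → f x ≡ y
  onto = injective⇒surjective f f-injective

-- Sorting the elements of Fin n by an injective key: the element placed at
-- position i is the one whose key has exactly i smaller keys below it.
module Sorting {n : ℕ} (key : Fin n → ℕ) (key-injective : Injective _≡_ _≡_ key) where

  smaller : Fin n → Subset n
  smaller a = tabulate (λ x → key x ℕ.<ᵇ key a)

  smaller⁺ : ∀ {x a} → key x ℕ.< key a → x ∈ smaller a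
  smaller⁺ {x} {a} lt =
    lookup⇒[]= x (smaller a) (trans (lookup∘tabulate _ x) (to T-≡ (ℕₚ.<⇒<ᵇ lt)))

  smaller⁻ : ∀ {x a} → x ∈ smaller a → key x ℕ.< key a
  smaller⁻ {x} {a} x∈ =
    ℕₚ.<ᵇ⇒< (key x) (key a) (from T-≡ (trans (sym (lookup∘tabulate _ x)) ([]=⇒lookup x∈)))

  not-smaller-than-itself : ∀ a → a ∉ smaller a
  not-smaller-than-itself a = ℕₚ.<-irrefl refl ∘ smaller⁻

  rank : Fin n → ℕ
  rank a = ∣ smaller a ∣

  rank<n : ∀ a → rank a ℕ.< n
  rank<n a = subst (rank a ℕ.<_) (∣⊤∣≡n n)
    (p⊂q⇒∣p∣<∣q∣ ((λ _ → ∈⊤) , a , ∈⊤ , not-smaller-than-itself a))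

  rank-mono : ∀ {a b} → key a ℕ.< key b → rank a ℕ.< rank b
  rank-mono {a} lt = p⊂q⇒∣p∣<∣q∣
    ((λ x∈ → smaller⁺ (ℕₚ.<-trans (smaller⁻ x∈) lt)) , a , smaller⁺ lt , not-smaller-than-itself a)

  rank-reflects-< : ∀ {a b} → rank a ℕ.< rank b → key a ℕ.< key b
  rank-reflects-< {a} {b} lt with ℕₚ.<-cmp (key a) (key b)
  ... | tri< key-lt _ _ = key-lt
  ... | tri≈ _ same _ rewrite key-injective same = ⊥-elim (ℕₚ.<-irrefl refl lt)
  ... | tri> _ _ key-gt = ⊥-elim (ℕₚ.<-asym lt (rank-mono key-gt))

  rank-injective : Injective _≡_ _≡_ rank
  rank-injective {a} {b} eq with ℕₚ.<-cmp (key a) (key b)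
  ... | tri< key-lt _ _ = ⊥-elim (ℕₚ.<-irrefl eq (rank-mono key-lt))
  ... | tri≈ _ same _ = key-injective same
  ... | tri> _ _ key-gt = ⊥-elim (ℕₚ.<-irrefl (sym eq) (rank-mono key-gt))

  position : Fin n → Fin n
  position a = fromℕ< (rank<n a)

  toℕ-position : ∀ a → toℕ (position a) ≡ rank a
  toℕ-position a = toℕ-fromℕ< (rank<n a)

  position-injective : Injective _≡_ _≡_ position
  position-injective {a} {b} eq =
    rank-injective (trans (sym (toℕ-position a)) (trans (cong toℕ eq) (toℕ-position b)))

  ranking : Permutation′ n
  ranking = injective⇒permutation position position-injective

  sorted : Permutation′ n
  sorted = flip ranking

  sorted-increasing : ∀ {i j} → i < j → key (sorted ⟨$⟩ʳ i) ℕ.< key (sorted ⟨$⟩ʳ j)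
  sorted-increasing {i} {j} lt = rank-reflects-< (subst₂ ℕ._<_ (rank-at i) (rank-at j) lt)
    where
    rank-at : ∀ i → toℕ i ≡ rank (sorted ⟨$⟩ʳ i)
    rank-at i = trans (cong toℕ (sym (inverseʳ ranking))) (toℕ-position (sorted ⟨$⟩ʳ i))

OrderedTriples : ∀ {n} → Permutation′ n → (Fin n → Fin n → Fin n → Set) → Set
OrderedTriples σ R = ∀ r s t → r < s → s < t → R (σ ⟨$⟩ʳ r) (σ ⟨$⟩ʳ s) (σ ⟨$⟩ʳ t)

subst₃ : ∀ {A : Set} (R : A → A → A → Set) {x x′ y y′ z z′} →
  x ≡ x′ → y ≡ y′ → z ≡ z′ → R x y z → R x′ y′ z′
subst₃ R refl refl refl holds = holds

module InducedOrdering {n N : ℕ} (f : Fin n → Fin N) (f-injective : Injective _≡_ _≡_ f)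
                       (σ : Permutation′ N) where

  key : Fin n → ℕ
  key a = toℕ (σ ⟨$⟩ˡ f a)

  key-injective : Injective _≡_ _≡_ key
  key-injective eq =
    f-injective (trans (sym (inverseʳ σ)) (trans (cong (σ ⟨$⟩ʳ_) (toℕ-injective eq)) (inverseʳ σ)))

  open Sorting key key-injective public
    using () renaming (sorted to induced; sorted-increasing to induced-increasing)

  position : Fin n → Fin N
  position i = σ ⟨$⟩ˡ f (induced ⟨$⟩ʳ i)

  at-position : ∀ i → σ ⟨$⟩ʳ position i ≡ f (induced ⟨$⟩ʳ i)
  at-position i = inverseʳ σ

  pullback : ∀ {R : Fin N → Fin N → Fin N → Set} {R′ : Fin n → Fin n → Fin n → Set} →
    (∀ {u v w} → R (f u) (f v) (f w) → R′ u v w) → OrderedTriples σ R → OrderedTriples induced R′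
  pullback {R} transfer holds r s t r<s s<t =
    transfer (subst₃ R (at-position r) (at-position s) (at-position t)
      (holds (position r) (position s) (position t) (induced-increasing r<s) (induced-increasing s<t)))

_⊕_ : ∀ {n m} → Permutation′ n → Permutation′ m → Permutation′ (n + m)
σ₁ ⊕ σ₂ = ↔-trans +↔⊎ (↔-trans (σ₁ ⊎-↔ σ₂) (↔-sym +↔⊎))

module _ {n m : ℕ} (σ₁ : Permutation′ n) (σ₂ : Permutation′ m) where

  ⊕-↑ˡ : ∀ a → (σ₁ ⊕ σ₂) ⟨$⟩ʳ (a ↑ˡ m) ≡ (σ₁ ⟨$⟩ʳ a) ↑ˡ m
  ⊕-↑ˡ a rewrite splitAt-↑ˡ n a m = refl

  ⊕-↑ʳ : ∀ b → (σ₁ ⊕ σ₂) ⟨$⟩ʳ (n ↑ʳ b) ≡ n ↑ʳ (σ₂ ⟨$⟩ʳ b)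
  ⊕-↑ʳ b rewrite splitAt-↑ʳ n m b = refl

data Block {n m : ℕ} : Fin (n + m) → Set where
  first  : (a : Fin n) → Block (a ↑ˡ m)
  second : (b : Fin m) → Block (n ↑ʳ b)

block : ∀ {n m} (i : Fin (n + m)) → Block {n} {m} i
block {n} i with splitAt n i in eq
... | inj₁ a = subst Block (splitAt⁻¹-↑ˡ eq) (first a)
... | inj₂ b = subst Block (splitAt⁻¹-↑ʳ eq) (second b)

first<second : ∀ {n m} (a : Fin n) (b : Fin m) → a ↑ˡ m < n ↑ʳ b
first<second {n} {m} a b rewrite toℕ-↑ˡ a m | toℕ-↑ʳ n b =
  ℕₚ.<-≤-trans (toℕ<n a) (ℕₚ.m≤m+n n (toℕ b))

second≮first : ∀ {n m} (a : Fin n) (b : Fin m) → ¬ (n ↑ʳ b < a ↑ˡ m)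
second≮first a b lt = ℕₚ.<-asym lt (first<second a b)

↑ˡ-cancel-< : ∀ {n m} {a b : Fin n} → a ↑ˡ m < b ↑ˡ m → a < b
↑ˡ-cancel-< {m = m} {a} {b} lt rewrite toℕ-↑ˡ a m | toℕ-↑ˡ b m = lt

↑ʳ-cancel-< : ∀ {n m} {a b : Fin m} → n ↑ʳ a < n ↑ʳ b → a < b
↑ʳ-cancel-< {n} {a = a} {b} lt rewrite toℕ-↑ʳ n a | toℕ-↑ʳ n b = ℕₚ.+-cancelˡ-< n _ _ lt

concatTriples : ∀ {n m} {σ₁ : Permutation′ n} {σ₂ : Permutation′ m}
  {R₁ : Fin n → Fin n → Fin n → Set} {R₂ : Fin m → Fin m → Fin m → Set}
  {R : Fin (n + m) → Fin (n + m) → Fin (n + m) → Set} →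
  (∀ {a b d} → R₁ a b d → R (a ↑ˡ m) (b ↑ˡ m) (d ↑ˡ m)) →
  (∀ {a b d} → R₂ a b d → R (n ↑ʳ a) (n ↑ʳ b) (n ↑ʳ d)) →
  (∀ a v d → R (a ↑ˡ m) v (n ↑ʳ d)) →
  OrderedTriples σ₁ R₁ → OrderedTriples σ₂ R₂ → OrderedTriples (σ₁ ⊕ σ₂) R
concatTriples {n} {m} {σ₁} {σ₂} into₁ into₂ crossing holds₁ holds₂ r s t r<s s<t
  with block {n} {m} r | block {n} {m} s | block {n} {m} t
... | first a  | first b  | first d
  rewrite ⊕-↑ˡ σ₁ σ₂ a | ⊕-↑ˡ σ₁ σ₂ b | ⊕-↑ˡ σ₁ σ₂ d =
    into₁ (holds₁ a b d (↑ˡ-cancel-< r<s) (↑ˡ-cancel-< s<t))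
... | first a  | first b  | second d rewrite ⊕-↑ˡ σ₁ σ₂ a | ⊕-↑ʳ σ₁ σ₂ d = crossing _ _ _
... | first a  | second b | second d rewrite ⊕-↑ˡ σ₁ σ₂ a | ⊕-↑ʳ σ₁ σ₂ d = crossing _ _ _
... | first a  | second b | first d  = ⊥-elim (second≮first d b s<t)
... | second a | first b  | _        = ⊥-elim (second≮first b a r<s)
... | second a | second b | first d  = ⊥-elim (second≮first d b s<t)
... | second a | second b | second d
  rewrite ⊕-↑ʳ σ₁ σ₂ a | ⊕-↑ʳ σ₁ σ₂ b | ⊕-↑ʳ σ₁ σ₂ d =
    into₂ (holds₂ a b d (↑ʳ-cancel-< r<s) (↑ʳ-cancel-< s<t))

-- The two vertex-level rules behind (strong) consistency, at the vertices
-- u, v, w placed at positions r < s < t: by definition, Consistent G σ c is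
-- OrderedTriples σ (ConsistentAt G c), and StronglyConsistent G σ c adds
-- OrderedTriples σ (BackConsistentAt G c).
ConsistentAt : ∀ {n k} → Graph n → (Fin n → Fin k) → Fin n → Fin n → Fin n → Set
ConsistentAt G c u v w = c u ≡ c v → E G w u → E G w v

BackConsistentAt : ∀ {n k} → Graph n → (Fin n → Fin k) → Fin n → Fin n → Fin n → Set
BackConsistentAt G c u v w = c v ≡ c w → E G w u → E G v u

record InducedEmbedding {n N : ℕ} (G : Graph n) (H : Graph N) : Set where
  field
    vertex           : Fin n → Fin N
    vertex-injective : Injective _≡_ _≡_ vertex
    edge             : ∀ {u v} → E G u v ⇔ E H (vertex u) (vertex v)
open InducedEmbedding

module _ {n N k k′ : ℕ} {G : Graph n} {H : Graph N} (e : InducedEmbedding G H)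
         (c′ : Fin n → Fin k′) (c : Fin N → Fin k)
         (classes : ∀ u v → c′ u ≡ c′ v ⇔ c (vertex e u) ≡ c (vertex e v)) where

  private
    f : Fin n → Fin N
    f = vertex e

  consistentAt⇔ : ∀ {u v w} → ConsistentAt G c′ u v w ⇔ ConsistentAt H c (f u) (f v) (f w)
  consistentAt⇔ {u} {v} = mk⇔
    (λ holds same adj → to (edge e) (holds (from (classes u v) same) (from (edge e) adj)))
    (λ holds same adj → from (edge e) (holds (to (classes u v) same) (to (edge e) adj)))

  backConsistentAt⇔ : ∀ {u v w} → BackConsistentAt G c′ u v w ⇔ BackConsistentAt H c (f u) (f v) (f w)
  backConsistentAt⇔ {v = v} {w} = mk⇔
    (λ holds same adj → to (edge e) (holds (from (classes v w) same) (from (edge e) adj)))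
    (λ holds same adj → from (edge e) (holds (to (classes v w) same) (to (edge e) adj)))

  independent-restrict : Independent H c → Independent G c′
  independent-restrict independent u v same adj =
    independent (f u) (f v) (to (classes u v) same) (to (edge e) adj)

module _ {n N k : ℕ} {G : Graph n} {H : Graph N} (e : InducedEmbedding G H) where

  private
    same-classes : ∀ (c : Fin N → Fin k) u v →
      c (vertex e u) ≡ c (vertex e v) ⇔ c (vertex e u) ≡ c (vertex e v)
    same-classes c _ _ = mk⇔ id id

  restrict-HasIndThin : HasIndThin H k → HasIndThin G k
  restrict-HasIndThin (σ , c , independent , consistent) =
    induced , c ∘ vertex e , independent-restrict e (c ∘ vertex e) c (same-classes c) independent ,
    pullback {R = ConsistentAt H c} (from (consistentAt⇔ e (c ∘ vertex e) c (same-classes c))) consistent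
    where open InducedOrdering (vertex e) (vertex-injective e) σ

  restrict-HasIndPThin : HasIndPThin H k → HasIndPThin G k
  restrict-HasIndPThin (σ , c , independent , consistent , back) =
    induced , c ∘ vertex e , independent-restrict e (c ∘ vertex e) c (same-classes c) independent ,
    pullback {R = ConsistentAt H c} (from (consistentAt⇔ e (c ∘ vertex e) c (same-classes c))) consistent ,
    pullback {R = BackConsistentAt H c} (from (backConsistentAt⇔ e (c ∘ vertex e) c (same-classes c))) back
    where open InducedOrdering (vertex e) (vertex-injective e) σ

≡⇒⇔ : ∀ {A B : Set} → A ≡ B → A ⇔ B
≡⇒⇔ refl = mk⇔ id id

module _ {n m : ℕ} (G₁ : Graph n) (G₂ : Graph m) where

  union-↑ˡ : ∀ a b → E (G₁ ∪ G₂) (a ↑ˡ m) (b ↑ˡ m) ≡ E G₁ a b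
  union-↑ˡ a b rewrite splitAt-↑ˡ n a m | splitAt-↑ˡ n b m = refl

  union-↑ʳ : ∀ a b → E (G₁ ∪ G₂) (n ↑ʳ a) (n ↑ʳ b) ≡ E G₂ a b
  union-↑ʳ a b rewrite splitAt-↑ʳ n m a | splitAt-↑ʳ n m b = refl

  union-no-crossing : ∀ a b → ¬ E (G₁ ∪ G₂) (n ↑ʳ b) (a ↑ˡ m)
  union-no-crossing a b rewrite splitAt-↑ˡ n a m | splitAt-↑ʳ n m b = id

  embed₁ : InducedEmbedding G₁ (G₁ ∪ G₂)
  embed₁ = record { vertex = _↑ˡ m ; vertex-injective = ↑ˡ-injective m _ _
                  ; edge = λ {a b} → ≡⇒⇔ (sym (union-↑ˡ a b)) }

  embed₂ : InducedEmbedding G₂ (G₁ ∪ G₂)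
  embed₂ = record { vertex = n ↑ʳ_ ; vertex-injective = ↑ʳ-injective n _ _
                  ; edge = λ {a b} → ≡⇒⇔ (sym (union-↑ʳ a b)) }

-- Classes are shared between
-- the parts, which is harmless as no edge joins them.
module _ {n m k₁ k₂ : ℕ} (c₁ : Fin n → Fin k₁) (c₂ : Fin m → Fin k₂) where

  private
    widen₁ : Fin k₁ → Fin (k₁ ⊔ k₂)
    widen₁ x = inject≤ x (ℕₚ.m≤m⊔n k₁ k₂)

    widen₂ : Fin k₂ → Fin (k₁ ⊔ k₂)
    widen₂ x = inject≤ x (ℕₚ.m≤n⊔m k₁ k₂)

  unionClasses : Fin (n + m) → Fin (k₁ ⊔ k₂)
  unionClasses i = [ widen₁ ∘ c₁ , widen₂ ∘ c₂ ]′ (splitAt n i)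

  unionClasses-↑ˡ : ∀ a b → c₁ a ≡ c₁ b ⇔ unionClasses (a ↑ˡ m) ≡ unionClasses (b ↑ˡ m)
  unionClasses-↑ˡ a b rewrite splitAt-↑ˡ n a m | splitAt-↑ˡ n b m =
    mk⇔ (cong widen₁) (inject≤-injective _ _ (c₁ a) (c₁ b))

  unionClasses-↑ʳ : ∀ a b → c₂ a ≡ c₂ b ⇔ unionClasses (n ↑ʳ a) ≡ unionClasses (n ↑ʳ b)
  unionClasses-↑ʳ a b rewrite splitAt-↑ʳ n m a | splitAt-↑ʳ n m b =
    mk⇔ (cong widen₂) (inject≤-injective _ _ (c₂ a) (c₂ b))

module _ {n m k₁ k₂ : ℕ} {G₁ : Graph n} {G₂ : Graph m} where

  union-independent : ∀ (c₁ : Fin n → Fin k₁) (c₂ : Fin m → Fin k₂) →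
    Independent G₁ c₁ → Independent G₂ c₂ → Independent (G₁ ∪ G₂) (unionClasses c₁ c₂)
  union-independent c₁ c₂ independent₁ independent₂ u v same adj
    with block {n} {m} u | block {n} {m} v
  ... | first a  | first b  =
    independent₁ a b (from (unionClasses-↑ˡ c₁ c₂ a b) same) (from (edge (embed₁ G₁ G₂)) adj)
  ... | first a  | second b = union-no-crossing G₁ G₂ a b (E-sym (G₁ ∪ G₂) adj)
  ... | second a | first b  = union-no-crossing G₁ G₂ b a adj
  ... | second a | second b =
    independent₂ a b (from (unionClasses-↑ʳ c₁ c₂ a b) same) (from (edge (embed₂ G₁ G₂)) adj)

  concat-consistent : ∀ σ₁ σ₂ (c₁ : Fin n → Fin k₁) (c₂ : Fin m → Fin k₂) →
    Consistent G₁ σ₁ c₁ → Consistent G₂ σ₂ c₂ → Consistent (G₁ ∪ G₂) (σ₁ ⊕ σ₂) (unionClasses c₁ c₂)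
  concat-consistent σ₁ σ₂ c₁ c₂ =
    concatTriples {σ₁ = σ₁} {σ₂} {ConsistentAt G₁ c₁} {ConsistentAt G₂ c₂}
                  {ConsistentAt (G₁ ∪ G₂) c}
      (to (consistentAt⇔ (embed₁ G₁ G₂) c₁ c (unionClasses-↑ˡ c₁ c₂)))
      (to (consistentAt⇔ (embed₂ G₁ G₂) c₂ c (unionClasses-↑ʳ c₁ c₂)))
      (λ a v d _ adj → ⊥-elim (union-no-crossing G₁ G₂ a d adj))
    where c = unionClasses c₁ c₂

  concat-backConsistent : ∀ σ₁ σ₂ (c₁ : Fin n → Fin k₁) (c₂ : Fin m → Fin k₂) →
    OrderedTriples σ₁ (BackConsistentAt G₁ c₁) → OrderedTriples σ₂ (BackConsistentAt G₂ c₂) →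
    OrderedTriples (σ₁ ⊕ σ₂) (BackConsistentAt (G₁ ∪ G₂) (unionClasses c₁ c₂))
  concat-backConsistent σ₁ σ₂ c₁ c₂ =
    concatTriples {σ₁ = σ₁} {σ₂} {BackConsistentAt G₁ c₁} {BackConsistentAt G₂ c₂}
                  {BackConsistentAt (G₁ ∪ G₂) c}
      (to (backConsistentAt⇔ (embed₁ G₁ G₂) c₁ c (unionClasses-↑ˡ c₁ c₂)))
      (to (backConsistentAt⇔ (embed₂ G₁ G₂) c₂ c (unionClasses-↑ʳ c₁ c₂)))
      (λ a v d _ adj → ⊥-elim (union-no-crossing G₁ G₂ a d adj))
    where c = unionClasses c₁ c₂

  union-HasIndThin : HasIndThin G₁ k₁ → HasIndThin G₂ k₂ → HasIndThin (G₁ ∪ G₂) (k₁ ⊔ k₂)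
  union-HasIndThin (σ₁ , c₁ , independent₁ , consistent₁) (σ₂ , c₂ , independent₂ , consistent₂) =
    σ₁ ⊕ σ₂ , unionClasses c₁ c₂ , union-independent c₁ c₂ independent₁ independent₂ ,
    concat-consistent σ₁ σ₂ c₁ c₂ consistent₁ consistent₂

  union-HasIndPThin : HasIndPThin G₁ k₁ → HasIndPThin G₂ k₂ → HasIndPThin (G₁ ∪ G₂) (k₁ ⊔ k₂)
  union-HasIndPThin (σ₁ , c₁ , independent₁ , consistent₁ , back₁)
                    (σ₂ , c₂ , independent₂ , consistent₂ , back₂) =
    σ₁ ⊕ σ₂ , unionClasses c₁ c₂ , union-independent c₁ c₂ independent₁ independent₂ ,
    concat-consistent σ₁ σ₂ c₁ c₂ consistent₁ consistent₂ , concat-backConsistent σ₁ σ₂ c₁ c₂ back₁ back₂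

theorem4p9 : ∀ {n m} (G₁ : Graph n) (G₂ : Graph m) (k₁ k₂ : ℕ) →
    (IndThin G₁ k₁ → IndThin G₂ k₂ → IndThin (G₁ ∪ G₂) (k₁ ⊔ k₂)) ×
    (IndPThin G₁ k₁ → IndPThin G₂ k₂ → IndPThin (G₁ ∪ G₂) (k₁ ⊔ k₂))
theorem4p9 G₁ G₂ k₁ k₂ = indThin , indPThin
  where
  indThin : IndThin G₁ k₁ → IndThin G₂ k₂ → IndThin (G₁ ∪ G₂) (k₁ ⊔ k₂)
  indThin (thin₁ , minimal₁) (thin₂ , minimal₂) =
    union-HasIndThin thin₁ thin₂ ,
    λ j thin → ℕₚ.⊔-lub (minimal₁ j (restrict-HasIndThin (embed₁ G₁ G₂) thin))
                        (minimal₂ j (restrict-HasIndThin (embed₂ G₁ G₂) thin))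

  indPThin : IndPThin G₁ k₁ → IndPThin G₂ k₂ → IndPThin (G₁ ∪ G₂) (k₁ ⊔ k₂)
  indPThin (thin₁ , minimal₁) (thin₂ , minimal₂) =
    union-HasIndPThin thin₁ thin₂ ,
    λ j thin → ℕₚ.⊔-lub (minimal₁ j (restrict-HasIndPThin (embed₁ G₁ G₂) thin))
                        (minimal₂ j (restrict-HasIndPThin (embed₂ G₁ G₂) thin))
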